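{- Let $f$ be a function from the positive integers to the integers, and let $M,N$ be positive integers. Then \[ \sum_{i=1}^{N}\frac{q^{f(i)}\,u_{f(i+M)-f(i)}\,u_{f(i+M)+f(i)}}{u_{f(i)}^2\,u_{f(i+M)}^2}=\sum_{i=1}^{M}\frac{q^{f(i)}\,u_{f(i+N)-f(i)}\,u_{f(i+N)+f(i)}}{u_{f(i)}^2\,u_{f(i+N)}^2}, \] \[ \sum_{i=1}^{N}\frac{q^{f(i)}\,u_{f(i+M)-f(i)}\,u_{f(i+M)+f(i)}}{v_{f(i)}^2\,v_{f(i+M)}^2}=\sum_{i=1}^{M}\frac{q^{f(i)}\,u_{f(i+N)-f(i)}\,u_{f(i+N)+f(i)}}{v_{f(i)}^2\,v_{f(i+N)}^2}. \]
   Context: Let $p,q$ be complex numbers. The Lucas sequences $u_n=u_n(p,q)$ and $v_n=v_n(p,q)$ are defined by $u_0=0$, $u_1=1$, $v_0=2$, $v_1=p$, and $x_n=px_{n-1}-qx_{n-2}$ for $x\in\{u,v\}$. Let $\alpha,\beta$ be the roots of $x^2-px+q=0$, labeled so that $|\alpha|>|\beta|$, with discriminant $D=p^2-4q\neq0$; thus $\alpha+\beta=p$, $\alpha\beta=q$, $\alpha-\beta=\sqrt D$, and $u_n=(\alpha^n-\beta^n)/(\alpha-\beta)$, $v_n=\alpha^n+\beta^n$. These Binet formulas also define $u_n,v_n$ for negative integers $n$ (with $q\neq0$ understood whenever negative indices occur). As implicit in the statement, all denominators appearing are assumed nonzero. -}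

module Defs where

open import Level using (Level; _⊔_)
open import Data.Nat as ℕ using (ℕ; zero; suc)
open import Data.Integer as ℤ using (ℤ; +_; -[1+_])
open import Data.Product using (_×_; ∃)
open import Data.Sum using (_⊎_)
open import Relation.Nullary using (¬_)
open import Algebra.Bundles using (CommutativeRing)

-- The inverse operation is total (its value at 0 is
-- unconstrained and never used by the statement: all denominators are assumed
-- nonzero).
record Field (c ℓ : Level) : Set (Level.suc (c ⊔ ℓ)) where
  field
    commutativeRing : CommutativeRing c ℓ
  open CommutativeRing commutativeRing public
  field
    _⁻¹       : Carrier → Carrier
    ⁻¹-inverse : ∀ x → ¬ (x ≈ 0#) → (x * (x ⁻¹)) ≈ 1#
    1≉0       : ¬ (1# ≈ 0#)

module Lucas {c ℓ : Level} (F : Field c ℓ) (p q : Field.Carrier F) where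
  open Field F

  _/_ : Carrier → Carrier → Carrier
  x / y = x * (y ⁻¹)

  pow : Carrier → ℕ → Carrier
  pow x zero    = 1#
  pow x (suc n) = x * pow x n

  -- integer powers of q (q ≠ 0 is assumed whenever a negative exponent occurs)
  qpow : ℤ → Carrier
  qpow (+ n)      = pow q n
  qpow -[1+ n ]   = pow q (suc n) ⁻¹

  uℕ : ℕ → Carrier
  uℕ zero          = 0#
  uℕ (suc zero)    = 1#
  uℕ (suc (suc n)) = (p * uℕ (suc n)) - (q * uℕ n)

  vℕ : ℕ → Carrier
  vℕ zero          = 1# + 1#
  vℕ (suc zero)    = p
  vℕ (suc (suc n)) = (p * vℕ (suc n)) - (q * vℕ n)

  -- Extension to negative indices given by the Binet formulas:
  -- u_{-n} = - u_n / q^n ,  v_{-n} = v_n / q^n .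
  u : ℤ → Carrier
  u (+ n)    = uℕ n
  u -[1+ n ] = - (uℕ (suc n) / pow q (suc n))

  v : ℤ → Carrier
  v (+ n)    = vℕ n
  v -[1+ n ] = vℕ (suc n) / pow q (suc n)

  D : Carrier
  D = (p * p) - ((1# + 1# + 1# + 1#) * q)

  Σ₁ : ℕ → (ℕ → Carrier) → Carrier
  Σ₁ zero    g = 0#
  Σ₁ (suc n) g = Σ₁ n g + g (suc n)

  termU : (ℕ → ℤ) → ℕ → ℕ → Carrier
  termU f K i =
    (qpow (f i) * u (f (i ℕ.+ K) ℤ.- f i) * u (f (i ℕ.+ K) ℤ.+ f i))
      / ((u (f i) * u (f i)) * (u (f (i ℕ.+ K)) * u (f (i ℕ.+ K))))

  termV : (ℕ → ℤ) → ℕ → ℕ → Carrier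
  termV f K i =
    (qpow (f i) * u (f (i ℕ.+ K) ℤ.- f i) * u (f (i ℕ.+ K) ℤ.+ f i))
      / ((v (f i) * v (f i)) * (v (f (i ℕ.+ K)) * v (f (i ℕ.+ K))))

  NegIndexIn : (ℕ → ℤ) → ℕ → ℕ → Set
  NegIndexIn f n K =
    ∃ λ i → (1 ℕ.≤ i × i ℕ.≤ n) ×
      ((f i ℤ.< ℤ.0ℤ) ⊎ (f (i ℕ.+ K) ℤ.< ℤ.0ℤ)
        ⊎ (f (i ℕ.+ K) ℤ.- f i ℤ.< ℤ.0ℤ) ⊎ (f (i ℕ.+ K) ℤ.+ f i ℤ.< ℤ.0ℤ))

  NonzeroDenoms : (ℤ → Carrier) → (ℕ → ℤ) → ℕ → ℕ → Set ℓ
  NonzeroDenoms w f n K =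
    ∀ i → 1 ℕ.≤ i → i ℕ.≤ n → ¬ (w (f i) ≈ 0#) × ¬ (w (f (i ℕ.+ K)) ≈ 0#)

-- Put a = f(i), b = f(i+K) for the shift K ∈ {M, N}. The generalised Catalan identity
--   q^a u_{b−a} u_{b+a} = q^a u_b² − q^b u_a²,
-- together with v_n² = D u_n² + 4 q^n, turns every summand into Φ(a) − Φ(b), where
-- Φ(n) = q^n / u_n² (resp. q^n / (D v_n²)). Hence both sides of each identity equal
-- Σ_{i≤N} Φ(f i) + Σ_{i≤M} Φ(f i) − Σ_{i≤N+M} Φ(f i). Catalan's identity is proved
-- for 0 ≤ a ≤ b over ℕ from the addition formula and Cassini's identity, and extended
-- to all integers a, b through u_{−n} = −q^{−n} u_n.
module Submission where

open import Defs
open import Level using (Level)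
open import Algebra.Bundles using (CommutativeRing)
open import Data.Nat as ℕ using (ℕ; zero; suc; _≤_)
open import Data.Integer as ℤ using (ℤ; +_; -[1+_]; _⊖_)
import Data.Integer.Properties as ℤP
import Data.Integer.Tactic.RingSolver as ℤSolver
import Data.Nat.Properties as ℕP
open import Data.Sign as Sign using (Sign)
open import Data.Maybe using (Maybe; just; nothing)
open import Data.Product using (_×_; _,_; proj₁; proj₂)
open import Data.Sum using (_⊎_; inj₁; inj₂)
open import Function using (_∘_)
open import Relation.Nullary using (¬_; yes; no)
open import Relation.Binary.PropositionalEquality as P using (_≡_)
open import Algebra.Properties.CommutativeSemigroup ℕP.+-commutativeSemigroup using (xy∙z≈xz∙y)
open import Algebra.Solver.Ring.AlmostCommutativeRing
  using (fromCommutativeRing; _-Raw-AlmostCommutative⟶_)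

-- Integer coefficients act through ι n = n × 1#, in the type-checking-optimised form
-- for which ι 1 = 1# and ι 4 = 1# + 1# + 1# + 1# hold definitionally, so that
-- con (+ 1) and con (+ 4) in solver equations match 1# and the 4 in D.
module IntegerCoefficientSolver {c ℓ : Level} (R : CommutativeRing c ℓ) where
  open CommutativeRing R
  open import Relation.Binary.Reasoning.Setoid setoid
  open import Algebra.Properties.Ring ring
    using (-0#≈0#; -‿distribˡ-*; -‿distribʳ-*; -‿involutive; -‿+-comm)
  open import Algebra.Properties.Semiring.Mult.TCOptimised semiring
    using (1+×; ×-homo-+; ×1-homo-*) renaming (_×_ to _×ᵣ_)

  ι : ℕ → Carrier
  ι n = n ×ᵣ 1#

  ⟦_⟧ℤ : ℤ → Carrier
  ⟦ + n ⟧ℤ      = ι n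
  ⟦ -[1+ n ] ⟧ℤ = - ι (suc n)

  ι-suc-minus : ∀ m n → ι (suc m) - ι (suc n) ≈ ι m - ι n
  ι-suc-minus m n = begin
    ι (suc m) - ι (suc n)      ≈⟨ +-cong (1+× m 1#) (-‿cong (1+× n 1#)) ⟩
    (1# + ι m) - (1# + ι n)    ≈⟨ +-congˡ (-‿+-comm 1# (ι n)) ⟨
    (1# + ι m) + (- 1# - ι n)  ≈⟨ +-assoc 1# (ι m) (- 1# - ι n) ⟩
    1# + (ι m + (- 1# - ι n))  ≈⟨ +-congˡ (+-assoc (ι m) (- 1#) (- ι n)) ⟨
    1# + ((ι m - 1#) - ι n)    ≈⟨ +-congˡ (+-congʳ (+-comm (ι m) (- 1#))) ⟩
    1# + ((- 1# + ι m) - ι n)  ≈⟨ +-congˡ (+-assoc (- 1#) (ι m) (- ι n)) ⟩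
    1# + (- 1# + (ι m - ι n))  ≈⟨ +-assoc 1# (- 1#) (ι m - ι n) ⟨
    (1# - 1#) + (ι m - ι n)    ≈⟨ +-congʳ (-‿inverseʳ 1#) ⟩
    0# + (ι m - ι n)           ≈⟨ +-identityˡ (ι m - ι n) ⟩
    ι m - ι n                  ∎

  ⊖-homo : ∀ m n → ⟦ m ⊖ n ⟧ℤ ≈ ι m - ι n
  ⊖-homo m zero = begin
    ⟦ m ⊖ 0 ⟧ℤ  ≡⟨ P.cong ⟦_⟧ℤ (ℤP.⊖-≥ {m} {0} ℕ.z≤n) ⟩
    ι m         ≈⟨ +-identityʳ (ι m) ⟨
    ι m + 0#    ≈⟨ +-congˡ -0#≈0# ⟨
    ι m - 0#    ∎
  ⊖-homo zero (suc n) = sym (+-identityˡ (- ι (suc n)))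
  ⊖-homo (suc m) (suc n) = begin
    ⟦ suc m ⊖ suc n ⟧ℤ       ≡⟨ P.cong ⟦_⟧ℤ (ℤP.[1+m]⊖[1+n]≡m⊖n m n) ⟩
    ⟦ m ⊖ n ⟧ℤ               ≈⟨ ⊖-homo m n ⟩
    ι m - ι n                ≈⟨ ι-suc-minus m n ⟨
    ι (suc m) - ι (suc n)    ∎

  +-homo : ∀ i j → ⟦ i ℤ.+ j ⟧ℤ ≈ ⟦ i ⟧ℤ + ⟦ j ⟧ℤ
  +-homo (+ m)    (+ n)    = ×-homo-+ 1# m n
  +-homo (+ m)    -[1+ n ] = ⊖-homo m (suc n)
  +-homo -[1+ m ] (+ n)    = trans (⊖-homo n (suc m)) (+-comm (ι n) (- ι (suc m)))
  +-homo -[1+ m ] -[1+ n ] = begin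
    - ι (suc (suc (m ℕ.+ n)))    ≡⟨ P.cong (λ k → - ι (suc k)) (ℕP.+-suc m n) ⟨
    - ι (suc m ℕ.+ suc n)        ≈⟨ -‿cong (×-homo-+ 1# (suc m) (suc n)) ⟩
    - (ι (suc m) + ι (suc n))    ≈⟨ -‿+-comm (ι (suc m)) (ι (suc n)) ⟨
    - ι (suc m) - ι (suc n)      ∎

  signed : Sign → Carrier → Carrier
  signed Sign.+ x = x
  signed Sign.- x = - x

  signed-cong : ∀ s {x y} → x ≈ y → signed s x ≈ signed s y
  signed-cong Sign.+ x≈y = x≈y
  signed-cong Sign.- x≈y = -‿cong x≈y

  signed-* : ∀ s t x y → signed (s Sign.* t) (x * y) ≈ signed s x * signed t y
  signed-* Sign.+ Sign.+ x y = refl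
  signed-* Sign.+ Sign.- x y = -‿distribʳ-* x y
  signed-* Sign.- Sign.+ x y = -‿distribˡ-* x y
  signed-* Sign.- Sign.- x y = begin
    x * y          ≈⟨ -‿involutive (x * y) ⟨
    - - (x * y)    ≈⟨ -‿cong (-‿distribˡ-* x y) ⟩
    - (- x * y)    ≈⟨ -‿distribʳ-* (- x) y ⟩
    - x * - y      ∎

  ◃-homo : ∀ s n → ⟦ s ℤ.◃ n ⟧ℤ ≈ signed s (ι n)
  ◃-homo Sign.+ zero    = refl
  ◃-homo Sign.- zero    = sym -0#≈0#
  ◃-homo Sign.+ (suc n) = refl
  ◃-homo Sign.- (suc n) = refl

  ⟦⟧-signAbs : ∀ i → ⟦ i ⟧ℤ ≈ signed (ℤ.sign i) (ι ℤ.∣ i ∣)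
  ⟦⟧-signAbs (+ n)    = refl
  ⟦⟧-signAbs -[1+ n ] = refl

  *-homo : ∀ i j → ⟦ i ℤ.* j ⟧ℤ ≈ ⟦ i ⟧ℤ * ⟦ j ⟧ℤ
  *-homo i j = begin
    ⟦ s ℤ.◃ (∣i∣ ℕ.* ∣j∣) ⟧ℤ                              ≈⟨ ◃-homo s (∣i∣ ℕ.* ∣j∣) ⟩
    signed s (ι (∣i∣ ℕ.* ∣j∣))                             ≈⟨ signed-cong s (×1-homo-* ∣i∣ ∣j∣) ⟩
    signed s (ι ∣i∣ * ι ∣j∣)                               ≈⟨ signed-* (ℤ.sign i) (ℤ.sign j) _ _ ⟩
    signed (ℤ.sign i) (ι ∣i∣) * signed (ℤ.sign j) (ι ∣j∣)  ≈⟨ *-cong (⟦⟧-signAbs i) (⟦⟧-signAbs j) ⟨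
    ⟦ i ⟧ℤ * ⟦ j ⟧ℤ                                        ∎
    where
    s = ℤ.sign i Sign.* ℤ.sign j
    ∣i∣ = ℤ.∣ i ∣
    ∣j∣ = ℤ.∣ j ∣

  -‿homo : ∀ i → ⟦ ℤ.- i ⟧ℤ ≈ - ⟦ i ⟧ℤ
  -‿homo (+ zero)  = sym -0#≈0#
  -‿homo (+ suc n) = refl
  -‿homo -[1+ n ]  = sym (-‿involutive _)

  ℤ-homomorphism : CommutativeRing.rawRing ℤP.+-*-commutativeRing
                     -Raw-AlmostCommutative⟶ fromCommutativeRing R
  ℤ-homomorphism = record
    { ⟦_⟧ = ⟦_⟧ℤ ; +-homo = +-homo ; *-homo = *-homo ; -‿homo = -‿homo
    ; 0-homo = refl ; 1-homo = refl }

  ≡⇒⟦⟧≈ : ∀ i j → Maybe (⟦ i ⟧ℤ ≈ ⟦ j ⟧ℤ)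
  ≡⇒⟦⟧≈ i j with i ℤ.≟ j
  ... | yes P.refl = just refl
  ... | no _       = nothing

  open import Algebra.Solver.Ring _ _ ℤ-homomorphism ≡⇒⟦⟧≈ public

module FieldProperties {c ℓ : Level} (F : Field c ℓ) where
  open Field F
  open IntegerCoefficientSolver commutativeRing
  open import Relation.Binary.Reasoning.Setoid setoid

  ⁻¹-unique : ∀ {x y} → ¬ (x ≈ 0#) → x * y ≈ 1# → y ≈ x ⁻¹
  ⁻¹-unique {x} {y} x≉0 xy≈1 = begin
    y                ≈⟨ *-identityʳ y ⟨
    y * 1#           ≈⟨ *-congˡ (⁻¹-inverse x x≉0) ⟨
    y * (x * x ⁻¹)   ≈⟨ *-assoc y x (x ⁻¹) ⟨
    (y * x) * x ⁻¹   ≈⟨ *-congʳ (trans (*-comm y x) xy≈1) ⟩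
    1# * x ⁻¹        ≈⟨ *-identityˡ (x ⁻¹) ⟩
    x ⁻¹             ∎

  *-nonzero : ∀ {x y} → ¬ (x ≈ 0#) → ¬ (y ≈ 0#) → ¬ (x * y ≈ 0#)
  *-nonzero {x} {y} x≉0 y≉0 xy≈0 = y≉0 (begin
    y                ≈⟨ *-identityˡ y ⟨
    1# * y           ≈⟨ *-congʳ (trans (*-comm (x ⁻¹) x) (⁻¹-inverse x x≉0)) ⟨
    (x ⁻¹ * x) * y   ≈⟨ *-assoc (x ⁻¹) x y ⟩
    x ⁻¹ * (x * y)   ≈⟨ *-congˡ xy≈0 ⟩
    x ⁻¹ * 0#        ≈⟨ zeroʳ (x ⁻¹) ⟩
    0#               ∎)

  ⁻¹-distrib-* : ∀ {x y} → ¬ (x ≈ 0#) → ¬ (y ≈ 0#) → (x * y) ⁻¹ ≈ x ⁻¹ * y ⁻¹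
  ⁻¹-distrib-* {x} {y} x≉0 y≉0 = sym (⁻¹-unique (*-nonzero x≉0 y≉0) (begin
    (x * y) * (x ⁻¹ * y ⁻¹)    ≈⟨ solve 4 (λ x y x′ y′ → (x :* y) :* (x′ :* y′) := (x :* x′) :* (y :* y′))
                                       refl x y (x ⁻¹) (y ⁻¹) ⟩
    (x * x ⁻¹) * (y * y ⁻¹)    ≈⟨ *-cong (⁻¹-inverse x x≉0) (⁻¹-inverse y y≉0) ⟩
    1# * 1#                    ≈⟨ *-identityˡ 1# ⟩
    1#                         ∎))

  ⁻¹-cong : ∀ {x y} → ¬ (y ≈ 0#) → x ≈ y → x ⁻¹ ≈ y ⁻¹
  ⁻¹-cong {x} {y} y≉0 x≈y = ⁻¹-unique y≉0 (trans (*-congʳ (sym x≈y)) (⁻¹-inverse x x≉0))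
    where
    x≉0 : ¬ (x ≈ 0#)
    x≉0 x≈0 = y≉0 (trans (sym x≈y) x≈0)

  1⁻¹≈1 : 1# ⁻¹ ≈ 1#
  1⁻¹≈1 = sym (⁻¹-unique 1≉0 (*-identityˡ 1#))

  quotient-as-difference : ∀ {c z x y a b} → ¬ (c ≈ 0#) → ¬ (a ≈ 0#) → ¬ (b ≈ 0#)
    → c * z ≈ x * b - y * a
    → z * (a * b) ⁻¹ ≈ c ⁻¹ * (x * a ⁻¹) - c ⁻¹ * (y * b ⁻¹)
  quotient-as-difference {c} {z} {x} {y} {a} {b} c≉0 a≉0 b≉0 cz≈xb-ya = begin
    z * (a * b) ⁻¹                                        ≈⟨ *-congˡ (⁻¹-distrib-* a≉0 b≉0) ⟩
    z * (a ⁻¹ * b ⁻¹)                                     ≈⟨ *-congʳ c⁻¹cz≈z ⟨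
    (c ⁻¹ * (c * z)) * (a ⁻¹ * b ⁻¹)                      ≈⟨ *-congʳ (*-congˡ cz≈xb-ya) ⟩
    c ⁻¹ * (x * b - y * a) * (a ⁻¹ * b ⁻¹)
      ≈⟨ solve 7 (λ c′ x y a b a′ b′ → c′ :* (x :* b :- y :* a) :* (a′ :* b′)
                    := c′ :* (x :* a′) :* (b :* b′) :- c′ :* (y :* b′) :* (a :* a′))
                 refl (c ⁻¹) x y a b (a ⁻¹) (b ⁻¹) ⟩
    c ⁻¹ * (x * a ⁻¹) * (b * b ⁻¹) - c ⁻¹ * (y * b ⁻¹) * (a * a ⁻¹)
      ≈⟨ +-cong (cancel b≉0) (-‿cong (cancel a≉0)) ⟩
    c ⁻¹ * (x * a ⁻¹) - c ⁻¹ * (y * b ⁻¹)                 ∎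
    where
    cancel : ∀ {w t} → ¬ (w ≈ 0#) → t * (w * w ⁻¹) ≈ t
    cancel {w} {t} w≉0 = trans (*-congˡ (⁻¹-inverse w w≉0)) (*-identityʳ t)
    c⁻¹cz≈z : c ⁻¹ * (c * z) ≈ z
    c⁻¹cz≈z = begin
      c ⁻¹ * (c * z)   ≈⟨ *-assoc (c ⁻¹) c z ⟨
      (c ⁻¹ * c) * z   ≈⟨ *-congʳ (trans (*-comm (c ⁻¹) c) (⁻¹-inverse c c≉0)) ⟩
      1# * z           ≈⟨ *-identityˡ z ⟩
      z                ∎

module LucasProperties {c ℓ : Level} (F : Field c ℓ) (p q : Field.Carrier F) where
  open Field F
  open Lucas F p q
  open IntegerCoefficientSolver commutativeRing
  open FieldProperties F
  open import Relation.Binary.Reasoning.Setoid setoid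

  pow-+ : ∀ x m n → pow x (m ℕ.+ n) ≈ pow x m * pow x n
  pow-+ x zero    n = sym (*-identityˡ (pow x n))
  pow-+ x (suc m) n = trans (*-congˡ (pow-+ x m n)) (sym (*-assoc x (pow x m) (pow x n)))

  pow-nonzero : ∀ {x} → ¬ (x ≈ 0#) → ∀ n → ¬ (pow x n ≈ 0#)
  pow-nonzero x≉0 zero    = 1≉0
  pow-nonzero x≉0 (suc n) = *-nonzero x≉0 (pow-nonzero x≉0 n)

  uℕ-+ : ∀ n m → uℕ (suc (n ℕ.+ m)) ≈ uℕ (suc m) * uℕ (suc n) - q * (uℕ m * uℕ n)
  uℕ-+ zero m = solve 3 (λ x y q → x := x :* con (+ 1) :- q :* (y :* con (+ 0))) refl (uℕ (suc m)) (uℕ m) q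
  uℕ-+ (suc zero) m =
    solve 4 (λ x y p q → p :* x :- q :* y := x :* (p :* con (+ 1) :- q :* con (+ 0)) :- q :* (y :* con (+ 1)))
          refl (uℕ (suc m)) (uℕ m) p q
  uℕ-+ (suc (suc n)) m = begin
    p * uℕ (suc (suc n ℕ.+ m)) - q * uℕ (suc (n ℕ.+ m))
      ≈⟨ +-cong (*-congˡ (uℕ-+ (suc n) m)) (-‿cong (*-congˡ (uℕ-+ n m))) ⟩
    p * (A * (p * Y - q * Z) - q * (B * Y)) - q * (A * Y - q * (B * Z))
      ≈⟨ solve 6 (λ A B p q Y Z → p :* (A :* (p :* Y :- q :* Z) :- q :* (B :* Y)) :- q :* (A :* Y :- q :* (B :* Z))
                   := A :* (p :* (p :* Y :- q :* Z) :- q :* Y) :- q :* (B :* (p :* Y :- q :* Z))) refl A B p q Y Z ⟩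
    A * (p * (p * Y - q * Z) - q * Y) - q * (B * (p * Y - q * Z)) ∎
    where
    A = uℕ (suc m)
    B = uℕ m
    Y = uℕ (suc n)
    Z = uℕ n

  uℕ-cassini : ∀ n → uℕ (suc n) * uℕ (suc n) - p * (uℕ (suc n) * uℕ n) + q * (uℕ n * uℕ n) ≈ pow q n
  uℕ-cassini zero =
    solve 2 (λ p q → con (+ 1) :* con (+ 1) :- p :* (con (+ 1) :* con (+ 0)) :+ q :* (con (+ 0) :* con (+ 0))
                     := con (+ 1)) refl p q
  uℕ-cassini (suc n) = begin
    (p * x - q * y) * (p * x - q * y) - p * ((p * x - q * y) * x) + q * (x * x)
      ≈⟨ solve 4 (λ p q x y → (p :* x :- q :* y) :* (p :* x :- q :* y) :- p :* ((p :* x :- q :* y) :* x) :+ q :* (x :* x)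
                   := q :* (x :* x :- p :* (x :* y) :+ q :* (y :* y))) refl p q x y ⟩
    q * (x * x - p * (x * y) + q * (y * y))   ≈⟨ *-congˡ (uℕ-cassini n) ⟩
    q * pow q n                               ∎
    where
    x = uℕ (suc n)
    y = uℕ n

  -- Catalan's identity u_n² − u_{n−r} u_{n+r} = q^{n−r} u_r², with n = a + d + 1 and r = a + 1.
  uℕ-catalan : ∀ d a → uℕ d * uℕ (suc ((a ℕ.+ suc a) ℕ.+ d)) + pow q d * (uℕ (suc a) * uℕ (suc a))
                       ≈ uℕ (suc (a ℕ.+ d)) * uℕ (suc (a ℕ.+ d))
  uℕ-catalan d a = begin
    x * uℕ (suc ((a ℕ.+ suc a) ℕ.+ d)) + pow q d * (z * z)
      ≈⟨ +-cong (*-congˡ (uℕ-+ (a ℕ.+ suc a) d)) (*-congʳ (sym (uℕ-cassini d))) ⟩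
    x * (y * uℕ (suc (a ℕ.+ suc a)) - q * (x * uℕ (a ℕ.+ suc a))) + (y * y - p * (y * x) + q * (x * x)) * (z * z)
      ≈⟨ +-congʳ (*-congˡ (+-cong (*-congˡ (uℕ-+ a (suc a))) (-‿cong (*-congˡ (*-congˡ u[2a+1]))))) ⟩
    x * (y * ((p * z - q * w) * z - q * (z * w)) - q * (x * (z * z - q * (w * w))))
      + (y * y - p * (y * x) + q * (x * x)) * (z * z)
      ≈⟨ solve 6 (λ p q x y z w →
           x :* (y :* ((p :* z :- q :* w) :* z :- q :* (z :* w)) :- q :* (x :* (z :* z :- q :* (w :* w))))
             :+ (y :* y :- p :* (y :* x) :+ q :* (x :* x)) :* (z :* z)
           := (y :* z :- q :* (x :* w)) :* (y :* z :- q :* (x :* w))) refl p q x y z w ⟩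
    (y * z - q * (x * w)) * (y * z - q * (x * w))   ≈⟨ *-cong (uℕ-+ a d) (uℕ-+ a d) ⟨
    uℕ (suc (a ℕ.+ d)) * uℕ (suc (a ℕ.+ d))          ∎
    where
    x = uℕ d
    y = uℕ (suc d)
    z = uℕ (suc a)
    w = uℕ a
    u[2a+1] : uℕ (a ℕ.+ suc a) ≈ z * z - q * (w * w)
    u[2a+1] = trans (reflexive (P.cong uℕ (ℕP.+-suc a a))) (uℕ-+ a a)

  Catalan : ℤ → ℤ → Set ℓ
  Catalan a b = qpow a * u (b ℤ.- a) * u (b ℤ.+ a) ≈ qpow a * (u b * u b) - qpow b * (u a * u a)

  catalanℕ : ∀ a k → pow q a * uℕ k * uℕ ((a ℕ.+ k) ℕ.+ a)
                     ≈ pow q a * (uℕ (a ℕ.+ k) * uℕ (a ℕ.+ k)) - pow q (a ℕ.+ k) * (uℕ a * uℕ a)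
  catalanℕ zero k = begin
    1# * uℕ k * uℕ (k ℕ.+ 0)    ≡⟨ P.cong (λ j → 1# * uℕ k * uℕ j) (ℕP.+-identityʳ k) ⟩
    1# * uℕ k * uℕ k
      ≈⟨ solve 2 (λ x P → con (+ 1) :* x :* x := con (+ 1) :* (x :* x) :- P :* (con (+ 0) :* con (+ 0)))
                 refl (uℕ k) (pow q k) ⟩
    1# * (uℕ k * uℕ k) - pow q k * (0# * 0#)   ∎
  catalanℕ (suc a) k = begin
    qᵃ * x * uℕ (suc ((a ℕ.+ k) ℕ.+ suc a))   ≡⟨ P.cong (λ j → qᵃ * x * uℕ (suc j)) (xy∙z≈xz∙y a k (suc a)) ⟩
    qᵃ * x * U
      ≈⟨ solve 5 (λ qᵃ x U qᵏ zz → qᵃ :* x :* U := qᵃ :* (x :* U :+ qᵏ :* zz) :- (qᵃ :* qᵏ) :* zz)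
                 refl qᵃ x U (pow q k) zz ⟩
    qᵃ * (x * U + pow q k * zz) - (qᵃ * pow q k) * zz
      ≈⟨ +-cong (*-congˡ (uℕ-catalan k a)) (-‿cong (*-congʳ (sym (pow-+ q (suc a) k)))) ⟩
    qᵃ * (uℕ (suc (a ℕ.+ k)) * uℕ (suc (a ℕ.+ k))) - pow q (suc a ℕ.+ k) * zz ∎
    where
    qᵃ = pow q (suc a)
    x = uℕ k
    U = uℕ (suc ((a ℕ.+ suc a) ℕ.+ k))
    zz = uℕ (suc a) * uℕ (suc a)

  catalan-≤ : ∀ {a b} → a ℕ.≤ b → Catalan (+ a) (+ b)
  catalan-≤ {a} a≤b with ℕP.m≤n⇒∃[o]m+o≡n a≤b
  ... | k , P.refl = begin
    pow q a * u (+ (a ℕ.+ k) ℤ.- + a) * uℕ ((a ℕ.+ k) ℕ.+ a)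
      ≡⟨ P.cong (λ j → pow q a * u j * uℕ ((a ℕ.+ k) ℕ.+ a)) [a+k]-a≡k ⟩
    pow q a * uℕ k * uℕ ((a ℕ.+ k) ℕ.+ a)   ≈⟨ catalanℕ a k ⟩
    _                                       ∎
    where
    [a+k]-a≡k : + (a ℕ.+ k) ℤ.- + a ≡ + k
    [a+k]-a≡k = P.trans (ℤP.m-n≡m⊖n (a ℕ.+ k) a)
                  (P.trans (ℤP.⊖-≥ (ℕP.m≤m+n a k)) (P.cong +_ (ℕP.m+n∸m≡n a k)))

  vℕ≈2uℕ-puℕ : ∀ n → vℕ n ≈ (1# + 1#) * uℕ (suc n) - p * uℕ n
  vℕ≈2uℕ-puℕ zero = solve 1 (λ p → con (+ 2) := con (+ 2) :* con (+ 1) :- p :* con (+ 0)) refl p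
  vℕ≈2uℕ-puℕ (suc zero) =
    solve 2 (λ p q → p := con (+ 2) :* (p :* con (+ 1) :- q :* con (+ 0)) :- p :* con (+ 1)) refl p q
  vℕ≈2uℕ-puℕ (suc (suc n)) = begin
    p * vℕ (suc n) - q * vℕ n    ≈⟨ +-cong (*-congˡ (vℕ≈2uℕ-puℕ (suc n))) (-‿cong (*-congˡ (vℕ≈2uℕ-puℕ n))) ⟩
    p * ((1# + 1#) * (p * Y - q * Z) - p * Y) - q * ((1# + 1#) * Y - p * Z)
      ≈⟨ solve 4 (λ p q Y Z → p :* (con (+ 2) :* (p :* Y :- q :* Z) :- p :* Y) :- q :* (con (+ 2) :* Y :- p :* Z)
                   := con (+ 2) :* (p :* (p :* Y :- q :* Z) :- q :* Y) :- p :* (p :* Y :- q :* Z)) refl p q Y Z ⟩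
    (1# + 1#) * (p * (p * Y - q * Z) - q * Y) - p * (p * Y - q * Z) ∎
    where
    Y = uℕ (suc n)
    Z = uℕ n

  VSquare : ℤ → Set ℓ
  VSquare i = v i * v i ≈ D * (u i * u i) + (1# + 1# + 1# + 1#) * qpow i

  vℕ-square : ∀ n → VSquare (+ n)
  vℕ-square n = begin
    vℕ n * vℕ n                                          ≈⟨ *-cong (vℕ≈2uℕ-puℕ n) (vℕ≈2uℕ-puℕ n) ⟩
    ((1# + 1#) * X - p * Y) * ((1# + 1#) * X - p * Y)
      ≈⟨ solve 4 (λ p q X Y → (con (+ 2) :* X :- p :* Y) :* (con (+ 2) :* X :- p :* Y)
            := (p :* p :- con (+ 4) :* q) :* (Y :* Y) :+ con (+ 4) :* (X :* X :- p :* (X :* Y) :+ q :* (Y :* Y)))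
           refl p q X Y ⟩
    D * (Y * Y) + (1# + 1# + 1# + 1#) * (X * X - p * (X * Y) + q * (Y * Y))
      ≈⟨ +-congˡ (*-congˡ (uℕ-cassini n)) ⟩
    D * (Y * Y) + (1# + 1# + 1# + 1#) * pow q n            ∎
    where
    X = uℕ (suc n)
    Y = uℕ n

  module NonzeroQ (q≉0 : ¬ (q ≈ 0#)) where

    qⁿq⁻ⁿ≈1 : ∀ n → pow q n * pow q n ⁻¹ ≈ 1#
    qⁿq⁻ⁿ≈1 n = ⁻¹-inverse (pow q n) (pow-nonzero q≉0 n)

    qpow-⊖ : ∀ m n → qpow (m ⊖ n) ≈ pow q m * pow q n ⁻¹
    qpow-⊖ m zero = begin
      qpow (m ⊖ 0)       ≡⟨ P.cong qpow (ℤP.⊖-≥ {m} {0} ℕ.z≤n) ⟩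
      pow q m            ≈⟨ trans (*-congˡ 1⁻¹≈1) (*-identityʳ (pow q m)) ⟨
      pow q m * 1# ⁻¹    ∎
    qpow-⊖ zero (suc n) = sym (*-identityˡ (pow q (suc n) ⁻¹))
    qpow-⊖ (suc m) (suc n) = begin
      qpow (suc m ⊖ suc n)                       ≡⟨ P.cong qpow (ℤP.[1+m]⊖[1+n]≡m⊖n m n) ⟩
      qpow (m ⊖ n)                               ≈⟨ qpow-⊖ m n ⟩
      qᵐ * q⁻ⁿ                                   ≈⟨ *-identityˡ (qᵐ * q⁻ⁿ) ⟨
      1# * (qᵐ * q⁻ⁿ)                            ≈⟨ *-congʳ (⁻¹-inverse q q≉0) ⟨
      (q * q ⁻¹) * (qᵐ * q⁻ⁿ)                    ≈⟨ solve 4 (λ a b c d → (a :* b) :* (c :* d) := (a :* c) :* (b :* d))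
                                                          refl q (q ⁻¹) qᵐ q⁻ⁿ ⟩
      (q * qᵐ) * (q ⁻¹ * q⁻ⁿ)                    ≈⟨ *-congˡ (⁻¹-distrib-* q≉0 (pow-nonzero q≉0 n)) ⟨
      (q * qᵐ) * (q * pow q n) ⁻¹                ∎
      where
      qᵐ = pow q m
      q⁻ⁿ = pow q n ⁻¹

    qpow-+ : ∀ i j → qpow (i ℤ.+ j) ≈ qpow i * qpow j
    qpow-+ (+ m)    (+ n)    = pow-+ q m n
    qpow-+ (+ m)    -[1+ n ] = qpow-⊖ m (suc n)
    qpow-+ -[1+ m ] (+ n)    = trans (qpow-⊖ n (suc m)) (*-comm (pow q n) (pow q (suc m) ⁻¹))
    qpow-+ -[1+ m ] -[1+ n ] = begin
      pow q (suc (suc (m ℕ.+ n))) ⁻¹        ≡⟨ P.cong (λ k → pow q (suc k) ⁻¹) (ℕP.+-suc m n) ⟨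
      pow q (suc m ℕ.+ suc n) ⁻¹            ≈⟨ ⁻¹-cong (*-nonzero (pow-nonzero q≉0 (suc m)) (pow-nonzero q≉0 (suc n)))
                                                       (pow-+ q (suc m) (suc n)) ⟩
      (pow q (suc m) * pow q (suc n)) ⁻¹    ≈⟨ ⁻¹-distrib-* (pow-nonzero q≉0 (suc m)) (pow-nonzero q≉0 (suc n)) ⟩
      pow q (suc m) ⁻¹ * pow q (suc n) ⁻¹   ∎

    qpow-inverse : ∀ i → qpow (ℤ.- i) * qpow i ≈ 1#
    qpow-inverse (+ zero)  = *-identityˡ 1#
    qpow-inverse (+ suc n) = trans (*-comm (pow q (suc n) ⁻¹) (pow q (suc n))) (qⁿq⁻ⁿ≈1 (suc n))
    qpow-inverse -[1+ n ]  = qⁿq⁻ⁿ≈1 (suc n)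

    u-neg : ∀ i → u (ℤ.- i) ≈ - (qpow (ℤ.- i) * u i)
    u-neg (+ zero)  = solve 0 (con (+ 0) := :- (con (+ 1) :* con (+ 0))) refl
    u-neg (+ suc n) = -‿cong (*-comm (uℕ (suc n)) (pow q (suc n) ⁻¹))
    u-neg -[1+ n ]  = begin
      uℕ (suc n)                                          ≈⟨ trans (*-congˡ (qⁿq⁻ⁿ≈1 (suc n))) (*-identityʳ (uℕ (suc n))) ⟨
      uℕ (suc n) * (pow q (suc n) * pow q (suc n) ⁻¹)     ≈⟨ solve 3 (λ U Q Q′ → U :* (Q :* Q′) := :- (Q :* (:- (U :* Q′))))
                                                                   refl (uℕ (suc n)) (pow q (suc n)) (pow q (suc n) ⁻¹) ⟩
      - (pow q (suc n) * (- (uℕ (suc n) * pow q (suc n) ⁻¹))) ∎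

    u-neg² : ∀ i → u (ℤ.- i) * u (ℤ.- i) ≈ (qpow (ℤ.- i) * qpow (ℤ.- i)) * (u i * u i)
    u-neg² i = trans (*-cong (u-neg i) (u-neg i))
      (solve 2 (λ Q U → (:- (Q :* U)) :* (:- (Q :* U)) := (Q :* Q) :* (U :* U)) refl (qpow (ℤ.- i)) (u i))

    catalan-swap : ∀ a b → Catalan a b → Catalan b a
    catalan-swap a b catalan = begin
      qpow b * u (a ℤ.- b) * u (a ℤ.+ b)       ≡⟨ P.cong₂ (λ s t → qpow b * u s * u t) (a-b≡-[b-a] a b) (ℤP.+-comm a b) ⟩
      qpow b * u (ℤ.- (b ℤ.- a)) * Y           ≈⟨ *-congʳ (*-congˡ (u-neg (b ℤ.- a))) ⟩
      qpow b * (- (Q * X)) * Y                 ≈⟨ solve 4 (λ qᵇ Q X Y → qᵇ :* (:- (Q :* X)) :* Y := :- ((qᵇ :* Q) :* X :* Y))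
                                                         refl (qpow b) Q X Y ⟩
      - ((qpow b * Q) * X * Y)                 ≈⟨ -‿cong (*-congʳ (*-congʳ qᵇQ≈qᵃ)) ⟩
      - (qpow a * X * Y)                       ≈⟨ -‿cong catalan ⟩
      - (qpow a * (u b * u b) - qpow b * (u a * u a))
        ≈⟨ solve 4 (λ x y z w → :- (x :* y :- z :* w) := z :* w :- x :* y) refl (qpow a) (u b * u b) (qpow b) (u a * u a) ⟩
      qpow b * (u a * u a) - qpow a * (u b * u b) ∎
      where
      X = u (b ℤ.- a)
      Y = u (b ℤ.+ a)
      Q = qpow (ℤ.- (b ℤ.- a))
      a-b≡-[b-a] : ∀ a b → a ℤ.- b ≡ ℤ.- (b ℤ.- a)
      a-b≡-[b-a] = ℤSolver.solve-∀
      b-[b-a]≡a : ∀ a b → b ℤ.+ ℤ.- (b ℤ.- a) ≡ a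
      b-[b-a]≡a = ℤSolver.solve-∀
      qᵇQ≈qᵃ : qpow b * Q ≈ qpow a
      qᵇQ≈qᵃ = trans (sym (qpow-+ b (ℤ.- (b ℤ.- a)))) (reflexive (P.cong qpow (b-[b-a]≡a a b)))

    catalan-negˡ : ∀ a b → Catalan a b → Catalan (ℤ.- a) b
    catalan-negˡ a b catalan = begin
      q⁻ᵃ * u (b ℤ.- ℤ.- a) * X                       ≡⟨ P.cong (λ s → q⁻ᵃ * u s * X) (b--a≡b+a a b) ⟩
      q⁻ᵃ * Y * X                                     ≈⟨ trans (*-congˡ (qpow-inverse a)) (*-identityʳ (q⁻ᵃ * Y * X)) ⟨
      q⁻ᵃ * Y * X * (q⁻ᵃ * qᵃ)
        ≈⟨ solve 4 (λ q⁻ᵃ qᵃ X Y → q⁻ᵃ :* Y :* X :* (q⁻ᵃ :* qᵃ) := (q⁻ᵃ :* q⁻ᵃ) :* (qᵃ :* X :* Y))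
                   refl q⁻ᵃ qᵃ X Y ⟩
      (q⁻ᵃ * q⁻ᵃ) * (qᵃ * X * Y)                      ≈⟨ *-congˡ catalan ⟩
      (q⁻ᵃ * q⁻ᵃ) * (qᵃ * (u b * u b) - qpow b * (u a * u a))
        ≈⟨ solve 5 (λ q⁻ᵃ qᵃ qᵇ ub² ua² → (q⁻ᵃ :* q⁻ᵃ) :* (qᵃ :* ub² :- qᵇ :* ua²)
                        := q⁻ᵃ :* ub² :* (q⁻ᵃ :* qᵃ) :- qᵇ :* ((q⁻ᵃ :* q⁻ᵃ) :* ua²))
                   refl q⁻ᵃ qᵃ (qpow b) (u b * u b) (u a * u a) ⟩
      q⁻ᵃ * (u b * u b) * (q⁻ᵃ * qᵃ) - qpow b * ((q⁻ᵃ * q⁻ᵃ) * (u a * u a))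
        ≈⟨ +-cong (trans (*-congˡ (qpow-inverse a)) (*-identityʳ _)) (-‿cong (*-congˡ (sym (u-neg² a)))) ⟩
      q⁻ᵃ * (u b * u b) - qpow b * (u (ℤ.- a) * u (ℤ.- a)) ∎
      where
      X = u (b ℤ.- a)
      Y = u (b ℤ.+ a)
      q⁻ᵃ = qpow (ℤ.- a)
      qᵃ = qpow a
      b--a≡b+a : ∀ a b → b ℤ.- ℤ.- a ≡ b ℤ.+ a
      b--a≡b+a = ℤSolver.solve-∀

    catalan-negʳ : ∀ a b → Catalan a b → Catalan a (ℤ.- b)
    catalan-negʳ a b catalan = begin
      qᵃ * u (ℤ.- b ℤ.- a) * u (ℤ.- b ℤ.+ a)    ≡⟨ P.cong₂ (λ s t → qᵃ * u s * u t) (-b-a≡-[b+a] a b) (-b+a≡-[b-a] a b) ⟩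
      qᵃ * u (ℤ.- (b ℤ.+ a)) * u (ℤ.- (b ℤ.- a)) ≈⟨ *-cong (*-congˡ (u-neg (b ℤ.+ a))) (u-neg (b ℤ.- a)) ⟩
      qᵃ * (- (Q₊ * Y)) * (- (Q₋ * X))           ≈⟨ solve 5 (λ qᵃ Q₊ Q₋ X Y → qᵃ :* (:- (Q₊ :* Y)) :* (:- (Q₋ :* X))
                                                                := (Q₊ :* Q₋) :* (qᵃ :* X :* Y)) refl qᵃ Q₊ Q₋ X Y ⟩
      (Q₊ * Q₋) * (qᵃ * X * Y)                   ≈⟨ *-cong Q₊Q₋≈q⁻ᵇq⁻ᵇ catalan ⟩
      (q⁻ᵇ * q⁻ᵇ) * (qᵃ * (u b * u b) - qpow b * (u a * u a))
        ≈⟨ solve 5 (λ q⁻ᵇ qᵃ qᵇ ub² ua² → (q⁻ᵇ :* q⁻ᵇ) :* (qᵃ :* ub² :- qᵇ :* ua²)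
                        := qᵃ :* ((q⁻ᵇ :* q⁻ᵇ) :* ub²) :- q⁻ᵇ :* ua² :* (q⁻ᵇ :* qᵇ))
                   refl q⁻ᵇ qᵃ (qpow b) (u b * u b) (u a * u a) ⟩
      qᵃ * ((q⁻ᵇ * q⁻ᵇ) * (u b * u b)) - q⁻ᵇ * (u a * u a) * (q⁻ᵇ * qpow b)
        ≈⟨ +-cong (*-congˡ (sym (u-neg² b))) (-‿cong (trans (*-congˡ (qpow-inverse b)) (*-identityʳ _))) ⟩
      qᵃ * (u (ℤ.- b) * u (ℤ.- b)) - q⁻ᵇ * (u a * u a) ∎
      where
      X = u (b ℤ.- a)
      Y = u (b ℤ.+ a)
      qᵃ = qpow a
      q⁻ᵇ = qpow (ℤ.- b)
      Q₊ = qpow (ℤ.- (b ℤ.+ a))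
      Q₋ = qpow (ℤ.- (b ℤ.- a))
      -b-a≡-[b+a] : ∀ a b → ℤ.- b ℤ.- a ≡ ℤ.- (b ℤ.+ a)
      -b-a≡-[b+a] = ℤSolver.solve-∀
      -b+a≡-[b-a] : ∀ a b → ℤ.- b ℤ.+ a ≡ ℤ.- (b ℤ.- a)
      -b+a≡-[b-a] = ℤSolver.solve-∀
      sum≡-b-b : ∀ a b → ℤ.- (b ℤ.+ a) ℤ.+ ℤ.- (b ℤ.- a) ≡ ℤ.- b ℤ.+ ℤ.- b
      sum≡-b-b = ℤSolver.solve-∀
      Q₊Q₋≈q⁻ᵇq⁻ᵇ : Q₊ * Q₋ ≈ q⁻ᵇ * q⁻ᵇ
      Q₊Q₋≈q⁻ᵇq⁻ᵇ = trans (sym (qpow-+ (ℤ.- (b ℤ.+ a)) (ℤ.- (b ℤ.- a))))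
                      (trans (reflexive (P.cong qpow (sum≡-b-b a b))) (qpow-+ (ℤ.- b) (ℤ.- b)))

    catalan-nonneg : ∀ m n → Catalan (+ m) (+ n)
    catalan-nonneg m n with m ℕ.≤? n
    ... | yes m≤n = catalan-≤ m≤n
    ... | no  m≰n = catalan-swap (+ n) (+ m) (catalan-≤ (ℕP.≰⇒≥ m≰n))

    catalan-nonnegˡ : ∀ m b → Catalan (+ m) b
    catalan-nonnegˡ m (+ n)    = catalan-nonneg m n
    catalan-nonnegˡ m -[1+ n ] = catalan-negʳ (+ m) (+ suc n) (catalan-nonneg m (suc n))

    catalanℤ : ∀ a b → Catalan a b
    catalanℤ (+ m)    b = catalan-nonnegˡ m b
    catalanℤ -[1+ m ] b = catalan-negˡ (+ suc m) b (catalan-nonnegˡ (suc m) b)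

    v-square : ∀ i → VSquare i
    v-square (+ n)    = vℕ-square n
    v-square -[1+ n ] = begin
      (V * r) * (V * r)                    ≈⟨ solve 2 (λ V r → (V :* r) :* (V :* r) := (V :* V) :* (r :* r)) refl V r ⟩
      (V * V) * (r * r)                    ≈⟨ *-congʳ (vℕ-square (suc n)) ⟩
      (D * (U * U) + (1# + 1# + 1# + 1#) * Q) * (r * r)
        ≈⟨ solve 4 (λ D U Q r → (D :* (U :* U) :+ con (+ 4) :* Q) :* (r :* r)
                        := D :* ((:- (U :* r)) :* (:- (U :* r))) :+ con (+ 4) :* r :* (Q :* r)) refl D U Q r ⟩
      D * ((- (U * r)) * (- (U * r))) + (1# + 1# + 1# + 1#) * r * (Q * r)
        ≈⟨ +-congˡ (trans (*-congˡ (qⁿq⁻ⁿ≈1 (suc n))) (*-identityʳ _)) ⟩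
      D * ((- (U * r)) * (- (U * r))) + (1# + 1# + 1# + 1#) * r ∎
      where
      V = vℕ (suc n)
      U = uℕ (suc n)
      Q = pow q (suc n)
      r = pow q (suc n) ⁻¹

  catalan-v : ∀ a b → Catalan a b → VSquare a → VSquare b
    → D * (qpow a * u (b ℤ.- a) * u (b ℤ.+ a)) ≈ qpow a * (v b * v b) - qpow b * (v a * v a)
  catalan-v a b catalan vaSquare vbSquare = begin
    D * (qpow a * u (b ℤ.- a) * u (b ℤ.+ a))       ≈⟨ *-congˡ catalan ⟩
    D * (qᵃ * (u b * u b) - qᵇ * (u a * u a))
      ≈⟨ solve 5 (λ D qᵃ qᵇ ub ua → D :* (qᵃ :* (ub :* ub) :- qᵇ :* (ua :* ua))
            := qᵃ :* (D :* (ub :* ub) :+ con (+ 4) :* qᵇ) :- qᵇ :* (D :* (ua :* ua) :+ con (+ 4) :* qᵃ))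
          refl D qᵃ qᵇ (u b) (u a) ⟩
    qᵃ * (D * (u b * u b) + (1# + 1# + 1# + 1#) * qᵇ) - qᵇ * (D * (u a * u a) + (1# + 1# + 1# + 1#) * qᵃ)
      ≈⟨ +-cong (*-congˡ vbSquare) (-‿cong (*-congˡ vaSquare)) ⟨
    qᵃ * (v b * v b) - qᵇ * (v a * v a)             ∎
    where
    qᵃ = qpow a
    qᵇ = qpow b

  NegativeIndex : ℤ → ℤ → Set
  NegativeIndex a b = (a ℤ.< ℤ.0ℤ) ⊎ (b ℤ.< ℤ.0ℤ) ⊎ (b ℤ.- a ℤ.< ℤ.0ℤ) ⊎ (b ℤ.+ a ℤ.< ℤ.0ℤ)

  catalan-at : ∀ a b → (NegativeIndex a b → ¬ (q ≈ 0#)) → Catalan a b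
  catalan-at -[1+ m ] b        q≉0 = NonzeroQ.catalanℤ (q≉0 (inj₁ ℤ.-<+)) -[1+ m ] b
  catalan-at (+ m)    -[1+ n ] q≉0 = NonzeroQ.catalanℤ (q≉0 (inj₂ (inj₁ ℤ.-<+))) (+ m) -[1+ n ]
  catalan-at (+ m)    (+ n)    q≉0 with m ℕ.≤? n
  ... | yes m≤n = catalan-≤ m≤n
  ... | no  m≰n = NonzeroQ.catalanℤ (q≉0 (inj₂ (inj₂ (inj₁ n-m<0)))) (+ m) (+ n)
    where
    n-m<0 : + n ℤ.- + m ℤ.< ℤ.0ℤ
    n-m<0 = ℤP.<-≤-trans (ℤP.+-monoˡ-< (ℤ.- + m) (ℤ.+<+ (ℕP.≰⇒> m≰n))) (ℤP.≤-reflexive (ℤP.+-inverseʳ (+ m)))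

  v-square-at : ∀ a → (a ℤ.< ℤ.0ℤ → ¬ (q ≈ 0#)) → VSquare a
  v-square-at (+ n)    _   = vℕ-square n
  v-square-at -[1+ n ] q≉0 = NonzeroQ.v-square (q≉0 ℤ.-<+) -[1+ n ]

  potential : Carrier → (ℤ → Carrier) → ℤ → Carrier
  potential c w a = c ⁻¹ * (qpow a / (w a * w a))

  termU-telescopes : ∀ f K n → (NegIndexIn f n K → ¬ (q ≈ 0#)) → NonzeroDenoms u f n K
    → ∀ i → 1 ℕ.≤ i → i ℕ.≤ n → termU f K i ≈ potential 1# u (f i) - potential 1# u (f (i ℕ.+ K))
  termU-telescopes f K n q≉0 nonzero i 1≤i i≤n =
    quotient-as-difference 1≉0 (*-nonzero ua≉0 ua≉0) (*-nonzero ub≉0 ub≉0)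
      (trans (*-identityˡ _) (catalan-at (f i) (f (i ℕ.+ K)) (λ neg → q≉0 (i , (1≤i , i≤n) , neg))))
    where
    ua≉0 = proj₁ (nonzero i 1≤i i≤n)
    ub≉0 = proj₂ (nonzero i 1≤i i≤n)

  termV-telescopes : ¬ (D ≈ 0#) → ∀ f K n → (NegIndexIn f n K → ¬ (q ≈ 0#)) → NonzeroDenoms v f n K
    → ∀ i → 1 ℕ.≤ i → i ℕ.≤ n → termV f K i ≈ potential D v (f i) - potential D v (f (i ℕ.+ K))
  termV-telescopes D≉0 f K n q≉0 nonzero i 1≤i i≤n =
    quotient-as-difference D≉0 (*-nonzero va≉0 va≉0) (*-nonzero vb≉0 vb≉0)
      (catalan-v a b (catalan-at a b q≉0ᵢ) (v-square-at a (q≉0ᵢ ∘ inj₁)) (v-square-at b (q≉0ᵢ ∘ inj₂ ∘ inj₁)))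
    where
    a = f i
    b = f (i ℕ.+ K)
    q≉0ᵢ : NegativeIndex a b → ¬ (q ≈ 0#)
    q≉0ᵢ neg = q≉0 (i , (1≤i , i≤n) , neg)
    va≉0 = proj₁ (nonzero i 1≤i i≤n)
    vb≉0 = proj₂ (nonzero i 1≤i i≤n)

  Σ₁-cong : ∀ n {g h : ℕ → Carrier} → (∀ i → 1 ℕ.≤ i → i ℕ.≤ n → g i ≈ h i) → Σ₁ n g ≈ Σ₁ n h
  Σ₁-cong zero    g≈h = refl
  Σ₁-cong (suc n) g≈h =
    +-cong (Σ₁-cong n (λ i 1≤i i≤n → g≈h i 1≤i (ℕP.m≤n⇒m≤1+n i≤n))) (g≈h (suc n) (ℕ.s≤s ℕ.z≤n) ℕP.≤-refl)

  Σ₁-minus : ∀ n (g h : ℕ → Carrier) → Σ₁ n (λ i → g i - h i) ≈ Σ₁ n g - Σ₁ n h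
  Σ₁-minus zero    g h = solve 0 (con (+ 0) := con (+ 0) :- con (+ 0)) refl
  Σ₁-minus (suc n) g h = begin
    Σ₁ n (λ i → g i - h i) + (g (suc n) - h (suc n))   ≈⟨ +-congʳ (Σ₁-minus n g h) ⟩
    (Σ₁ n g - Σ₁ n h) + (g (suc n) - h (suc n))        ≈⟨ solve 4 (λ a b c d → (a :- b) :+ (c :- d) := (a :+ c) :- (b :+ d))
                                                                  refl (Σ₁ n g) (Σ₁ n h) (g (suc n)) (h (suc n)) ⟩
    (Σ₁ n g + g (suc n)) - (Σ₁ n h + h (suc n))        ∎

  Σ₁-shift : ∀ (G : ℕ → Carrier) N M → Σ₁ N (λ i → G (i ℕ.+ M)) + Σ₁ M G ≈ Σ₁ (N ℕ.+ M) G
  Σ₁-shift G zero    M = +-identityˡ (Σ₁ M G)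
  Σ₁-shift G (suc N) M = begin
    (S + G (suc N ℕ.+ M)) + Σ₁ M G   ≈⟨ solve 3 (λ a b c → (a :+ b) :+ c := (a :+ c) :+ b) refl S (G (suc N ℕ.+ M)) (Σ₁ M G) ⟩
    (S + Σ₁ M G) + G (suc N ℕ.+ M)   ≈⟨ +-congʳ (Σ₁-shift G N M) ⟩
    Σ₁ (N ℕ.+ M) G + G (suc (N ℕ.+ M)) ∎
    where
    S = Σ₁ N (λ i → G (i ℕ.+ M))

  Σ₁-telescope-symmetric : ∀ (G : ℕ → Carrier) N M
    → Σ₁ N (λ i → G i - G (i ℕ.+ M)) ≈ Σ₁ M (λ i → G i - G (i ℕ.+ N))
  Σ₁-telescope-symmetric G N M = begin
    Σ₁ N (λ i → G i - G (i ℕ.+ M))    ≈⟨ Σ₁-minus N G (λ i → G (i ℕ.+ M)) ⟩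
    Sᴺ - A                            ≈⟨ solve 3 (λ Sᴺ A Sᴹ → Sᴺ :- A := Sᴹ :- ((A :+ Sᴹ) :- Sᴺ)) refl Sᴺ A Sᴹ ⟩
    Sᴹ - ((A + Sᴹ) - Sᴺ)              ≈⟨ +-congˡ (-‿cong (+-congʳ (Σ₁-shift G N M))) ⟩
    Sᴹ - (Σ₁ (N ℕ.+ M) G - Sᴺ)        ≡⟨ P.cong (λ k → Sᴹ - (Σ₁ k G - Sᴺ)) (ℕP.+-comm N M) ⟩
    Sᴹ - (Σ₁ (M ℕ.+ N) G - Sᴺ)        ≈⟨ +-congˡ (-‿cong (+-congʳ (Σ₁-shift G M N))) ⟨
    Sᴹ - ((B + Sᴺ) - Sᴺ)              ≈⟨ solve 3 (λ Sᴹ B Sᴺ → Sᴹ :- ((B :+ Sᴺ) :- Sᴺ) := Sᴹ :- B) refl Sᴹ B Sᴺ ⟩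
    Sᴹ - B                            ≈⟨ Σ₁-minus M G (λ i → G (i ℕ.+ N)) ⟨
    Σ₁ M (λ i → G i - G (i ℕ.+ N))    ∎
    where
    Sᴺ = Σ₁ N G
    Sᴹ = Σ₁ M G
    A = Σ₁ N (λ i → G (i ℕ.+ M))
    B = Σ₁ M (λ i → G (i ℕ.+ N))

  Σ₁-telescoping-swap : ∀ (t : ℕ → ℕ → Carrier) (G : ℕ → Carrier) N M
    → (∀ i → 1 ℕ.≤ i → i ℕ.≤ N → t M i ≈ G i - G (i ℕ.+ M))
    → (∀ i → 1 ℕ.≤ i → i ℕ.≤ M → t N i ≈ G i - G (i ℕ.+ N))
    → Σ₁ N (t M) ≈ Σ₁ M (t N)
  Σ₁-telescoping-swap t G N M tᴹ≈ tᴺ≈ = begin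
    Σ₁ N (t M)                        ≈⟨ Σ₁-cong N tᴹ≈ ⟩
    Σ₁ N (λ i → G i - G (i ℕ.+ M))    ≈⟨ Σ₁-telescope-symmetric G N M ⟩
    Σ₁ M (λ i → G i - G (i ℕ.+ N))    ≈⟨ Σ₁-cong M tᴺ≈ ⟨
    Σ₁ M (t N)                        ∎

theorem23 : ∀ {c ℓ : Level} (F : Field c ℓ) (p q : Field.Carrier F)
    → let open Field F in let open Lucas F p q in
      ¬ (D ≈ 0#)
    → (f : ℕ → ℤ) (M N : ℕ) → 1 ≤ M → 1 ≤ N
    → (NegIndexIn f N M ⊎ NegIndexIn f M N → ¬ (q ≈ 0#))
    → (NonzeroDenoms u f N M → NonzeroDenoms u f M N
         → Σ₁ N (termU f M) ≈ Σ₁ M (termU f N))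
      × (NonzeroDenoms v f N M → NonzeroDenoms v f M N
         → Σ₁ N (termV f M) ≈ Σ₁ M (termV f N))
theorem23 F p q D≉0 f M N _ _ q≉0 = sumsᵘ , sumsᵛ
  where
  open Field F
  open Lucas F p q
  open LucasProperties F p q
  sumsᵘ : NonzeroDenoms u f N M → NonzeroDenoms u f M N → Σ₁ N (termU f M) ≈ Σ₁ M (termU f N)
  sumsᵘ nonzeroᴺ nonzeroᴹ = Σ₁-telescoping-swap (termU f) (potential 1# u ∘ f) N M
    (termU-telescopes f M N (q≉0 ∘ inj₁) nonzeroᴺ) (termU-telescopes f N M (q≉0 ∘ inj₂) nonzeroᴹ)
  sumsᵛ : NonzeroDenoms v f N M → NonzeroDenoms v f M N → Σ₁ N (termV f M) ≈ Σ₁ M (termV f N)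
  sumsᵛ nonzeroᴺ nonzeroᴹ = Σ₁-telescoping-swap (termV f) (potential D v ∘ f) N M
    (termV-telescopes D≉0 f M N (q≉0 ∘ inj₁) nonzeroᴺ) (termV-telescopes D≉0 f N M (q≉0 ∘ inj₂) nonzeroᴹ)
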